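{- Let $\mathcal M=\mathrm{CM}(D_n,X,p)$ be a regular Cayley map with associated skew-morphism $\psi$ and power function $\pi$, and let $M=C_n\cap\mathrm{Ker}(\pi)$. If $|M|>2$, then $L(M)=\{L_g:g\in M\}$ is a normal subgroup of $\mathrm{Aut}(\mathcal M)$.
   Context: $D_n=\langle a,b\mid a^n=b^2=baba=1\rangle$, $C_n=\langle a\rangle$. For a finite group $G$, a generating subset $X\subseteq G$ with $X=X^{ -1}$, $1_G\notin X$, and a cyclic permutation $p$ of $X$, $\mathrm{CM}(G,X,p)$ is the map with underlying Cayley graph $\mathrm{Cay}(G,X)$ and rotation $(g,gx)\mapsto(g,g\,p(x))$; $\mathrm{Aut}(\mathcal M)$ is the group of dart permutations commuting with rotation and dart-reversal, and the map is regular if this group is transitive on darts. $\mathrm{Aut}(\mathcal M)$ is regarded as a permutation group on the vertex set $G$; it contains $L(G)=\{L_g\}$, $L_g(h)=gh$. A skew-morphism of $G$ is a permutation $\psi$ fixing $1_G$ with a function $\pi:G\to\{1,\dots,r\}$ ($r$ the order of $\psi$) such that $\psi(gh)=\psi(g)\psi^{\pi(g)}(h)$; a Cayley map is regular iff a skew-morphism $\psi$ agrees with $p$ on $X$, and this unique $\psi$ and its power function $\pi$ are the associated ones; then $\mathrm{Aut}(\mathcal M)=L(G)\langle\psi\rangle$. $\mathrm{Ker}(\pi)=\{g:\pi(g)=1\}$. -}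

module Defs where

open import Data.Nat using (ℕ; zero; suc; _+_; _∸_; _≤_; _<_; NonZero)
open import Data.Nat.DivMod using (_mod_)
open import Data.Fin using (Fin; toℕ)
open import Data.Bool using (Bool; true; false; not; T)
open import Data.Product using (Σ; ∃; _×_; _,_; proj₁; proj₂)
open import Data.List using (List; []; _∷_; foldr; length; filter; concatMap; allFin)
open import Data.List.Relation.Unary.All using (All)
open import Relation.Binary.PropositionalEquality using (_≡_; _≢_)
open import Relation.Nullary using (¬_)
open import Relation.Nullary.Decidable using (_×-dec_)
import Data.Nat.Properties as ℕP
import Data.Bool.Properties as BP

iter : {A : Set} → (A → A) → ℕ → A → A
iter f zero x = x
iter f (suc k) x = f (iter f k x)

-- Concrete model of the dihedral group D_n = ⟨a,b | a^n = b^2 = baba = 1⟩: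
-- the pair (i , s) represents a^i b^s  (s = false : b^0, s = true : b^1).
D : ℕ → Set
D n = Fin n × Bool

module Dihedral (n : ℕ) {{_ : NonZero n}} where

  e : D n
  e = (0 mod n , false)

  -- multiplication, using b a^k = a^(-k) b
  infixl 7 _·_
  _·_ : D n → D n → D n
  (i , false) · (k , t) = ((toℕ i + toℕ k) mod n , t)
  (i , true)  · (k , t) = ((toℕ i + (n ∸ toℕ k)) mod n , not t)

  inv : D n → D n
  inv (i , false) = ((n ∸ toℕ i) mod n , false)
  inv (i , true)  = (i , true)

  elems : List (D n)
  elems = concatMap (λ i → (i , false) ∷ (i , true) ∷ []) (allFin n)

  InC : D n → Set
  InC g = proj₂ g ≡ false

  record IsCayleySet (X : D n → Bool) : Set where
    field
      generates : ∀ g → Σ (List (D n)) λ xs → All (λ x → T (X x)) xs × foldr _·_ e xs ≡ g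
      symmetric : ∀ x → T (X x) → T (X (inv x))
      no-unit   : ¬ T (X e)

  record IsCyclicPermOn (X : D n → Bool) (p : D n → D n) : Set where
    field
      maps-into : ∀ x → T (X x) → T (X (p x))
      injective : ∀ x y → T (X x) → T (X y) → p x ≡ p y → x ≡ y
      cyclic    : ∀ x y → T (X x) → T (X y) → Σ ℕ λ k → iter p k x ≡ y

  record IsSkewMorphism (ψ : D n → D n) (π : D n → ℕ) : Set where
    field
      ψ⁻¹       : D n → D n
      inv-left  : ∀ g → ψ⁻¹ (ψ g) ≡ g
      inv-right : ∀ g → ψ (ψ⁻¹ g) ≡ g
      fixes-1   : ψ e ≡ e
      order     : ℕ
      order-pos : 1 ≤ order
      order-id  : ∀ g → iter ψ order g ≡ g
      order-min : ∀ s → 1 ≤ s → s < order → ¬ (∀ g → iter ψ s g ≡ g)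
      π-range   : ∀ g → 1 ≤ π g × π g ≤ order
      skew      : ∀ g h → ψ (g · h) ≡ ψ g · iter ψ (π g) h

  record IsRegularCayleyMapWith (X : D n → Bool) (p ψ : D n → D n) (π : D n → ℕ) : Set where
    field
      cayley-set : IsCayleySet X
      cyclic-rot : IsCyclicPermOn X p
      skew-morph : IsSkewMorphism ψ π
      agrees     : ∀ x → T (X x) → ψ x ≡ p x

  InM : (D n → ℕ) → D n → Set
  InM π g = InC g × π g ≡ 1

  cardM : (D n → ℕ) → ℕ
  cardM π = length (filter (λ g → (proj₂ g BP.≟ false) ×-dec (π g ℕP.≟ 1)) elems)

  -- L(M) = {L_m : m ∈ M} is a normal subgroup of Aut(M) = L(D_n)⟨ψ⟩ = {L_g ∘ ψ^k},
  -- viewed as permutation groups on D_n, with L_g(h) = g·h.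
  --   * L(M) is a subgroup: L_1 ∈ L(M), L_m ∘ L_m' = L_(m·m'), L_m⁻¹ = L_(m⁻¹);
  --   * normality: for σ = L_g ∘ ψ^k, σ ∘ L_m ∘ σ⁻¹ = L_m' for some m' ∈ M,
  --     i.e. σ ∘ L_m = L_m' ∘ σ.
  LMNormalInAut : (ψ : D n → D n) (π : D n → ℕ) → Set
  LMNormalInAut ψ π =
    InM π e
    × (∀ m m' → InM π m → InM π m' → InM π (m · m'))
    × (∀ m → InM π m → InM π (inv m))
    × (∀ (g : D n) (k : ℕ) m → InM π m →
         Σ (D n) λ m' → InM π m' × (∀ h → g · iter ψ k (m · h) ≡ m' · (g · iter ψ k h)))

-- M = C_n ∩ Ker π is a subgroup of D_n on which ψ is an injective homomorphism (π ≡ 1 there).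
-- As C_n has at most two elements x with x² = 1, |M| > 2 yields m₁ ∈ M with m₁² ≠ 1.
-- ψ maps M into C_n: if ψ m were a reflection then m² = 1, and one of ψ m₁, ψ (m m₁) would be a
-- reflection, forcing m₁² = 1 or (m m₁)² = m₁² = 1. Since ψ m ∈ C_n has order dividing that of m,
-- it lies in the cyclic group ⟨m⟩ ⊆ M. So M is ψ-invariant, every ψ^k is multiplicative on M,
-- and (L_g ψ^k) L_m (L_g ψ^k)⁻¹ = L_(g ψ^k(m) g⁻¹), where g ψ^k(m) g⁻¹ is ψ^k(m) or its inverse.
module Submission where

open import Defs

open import Algebra.Bundles using (Group)
open import Algebra.Core using (Op₁; Op₂)
import Algebra.Definitions as Definitions
import Algebra.Properties.Group as GroupProperties
import Algebra.Structures as Structures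
open import Data.Bool using (Bool; true; false; _xor_)
import Data.Bool.Properties as Bool
open import Data.Empty using (⊥-elim)
open import Data.Fin using (Fin; toℕ)
import Data.Fin.Properties as Fin
open import Data.List using ([]; _∷_; length; filter; concatMap; allFin; cartesianProduct)
open import Data.List.Relation.Unary.All using (All; []; _∷_)
open import Data.List.Relation.Unary.All.Properties using (all-filter)
open import Data.List.Relation.Unary.AllPairs using ([]; _∷_)
open import Data.List.Relation.Unary.Unique.Propositional using (Unique)
open import Data.List.Relation.Unary.Unique.Propositional.Properties using (allFin⁺; filter⁺; cartesianProduct⁺)
open import Data.Nat using (ℕ; zero; suc; pred; _+_; _*_; _∸_; _%_; _≤_; _<_; z≤n; s≤s; NonZero)
import Data.Nat.Properties as ℕ
open import Data.Nat.DivMod using (_mod_; m%n%n≡m%n; m%n≤n; m<n⇒m%n≡m; %-distribˡ-+; %-distribˡ-*)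
open import Data.Nat.Divisibility using (_∣_; divides; _∣0; n∣n; m∣m*n; n∣m*n; m%n≡0⇒n∣m; n∣m⇒m%n≡0; *-cancelˡ-∣)
open import Data.Nat.GCD using (gcd; gcd-GCD; gcd[m,n]∣m; gcd[m,n]∣n; module Bézout)
open import Data.Nat.Properties
  using (+-assoc; +-comm; +-identityʳ; *-assoc; m+[n∸m]≡n; suc-pred; m*n≢0⇒m≢0;
         *-cancelˡ-≡; m+n≡0⇒m≡0; *-monoʳ-<; *-monoˡ-≤; <-≤-trans; <-irrefl)
open import Data.Nat.Tactic.RingSolver using (solve-∀)
open import Data.Product using (Σ; ∃; _×_; _,_; proj₁; proj₂)
import Data.Product.Properties as Product
open import Data.Sum using (_⊎_; inj₁; inj₂; [_,_])
open import Function using (_∘_; it)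
open import Level using (0ℓ)
open import Relation.Binary using (Rel; Setoid)
import Relation.Binary.Construct.On as On
open import Relation.Binary.PropositionalEquality as ≡
  using (_≡_; _≢_; refl; sym; trans; cong; cong₂; subst; module ≡-Reasoning)
import Relation.Binary.Reasoning.Setoid as SetoidReasoning
open import Relation.Nullary using (Dec; yes; no)
open import Relation.Nullary.Decidable using (_×-dec_)

iter-preserves : ∀ {A : Set} {P : A → Set} {f : A → A} →
                 (∀ {x} → P x → P (f x)) → ∀ k {x} → P x → P (iter f k x)
iter-preserves f-preserves zero    Px = Px
iter-preserves {P = P} {f} f-preserves (suc k) Px =
  f-preserves (iter-preserves {P = P} {f} f-preserves k Px)

module Power {A : Set} (_∙_ : Op₂ A) (ε : A) where

  infixr 8 _^_
  _^_ : A → ℕ → A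
  x ^ zero  = ε
  x ^ suc c = x ∙ (x ^ c)

module SkewMorphismKernel
  {A : Set} {_∙_ : Op₂ A} {ε : A} {_⁻¹ : Op₁ A}
  (isGroup : Structures.IsGroup _≡_ _∙_ ε _⁻¹)
  (ψ : A → A) (π : A → ℕ)
  (ψ-injective : ∀ {x y} → ψ x ≡ ψ y → x ≡ y)
  (ψ-ε : ψ ε ≡ ε)
  (skew : ∀ g h → ψ (g ∙ h) ≡ ψ g ∙ iter ψ (π g) h)
  -- for a skew-morphism this follows from 1 ≤ π g ≤ |ψ| and the minimality of |ψ|
  (π-minimal : ∀ g → (∀ h → iter ψ (π g) h ≡ ψ h) → π g ≡ 1)
  where

  open Structures.IsGroup isGroup using (assoc; identityˡ; inverseʳ)

  group : Group 0ℓ 0ℓ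
  group = record { isGroup = isGroup }

  open GroupProperties group using (∙-cancelˡ; \\-leftDividesˡ)
  open Power _∙_ ε
  open ≡-Reasoning

  Ker : A → Set
  Ker g = π g ≡ 1

  ψ-hom : ∀ {g} → Ker g → ∀ h → ψ (g ∙ h) ≡ ψ g ∙ ψ h
  ψ-hom {g} π≡1 h = subst (λ k → ψ (g ∙ h) ≡ ψ g ∙ iter ψ k h) π≡1 (skew g h)

  Ker-ε : Ker ε
  Ker-ε = π-minimal ε λ h → begin
    iter ψ (π ε) h          ≡⟨ identityˡ _ ⟨
    ε ∙ iter ψ (π ε) h      ≡⟨ cong (_∙ iter ψ (π ε) h) ψ-ε ⟨
    ψ ε ∙ iter ψ (π ε) h    ≡⟨ skew ε h ⟨
    ψ (ε ∙ h)               ≡⟨ cong ψ (identityˡ h) ⟩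
    ψ h                     ∎

  Ker-∙ : ∀ {g h} → Ker g → Ker h → Ker (g ∙ h)
  Ker-∙ {g} {h} Ker-g Ker-h = π-minimal (g ∙ h) λ x → ∙-cancelˡ (ψ (g ∙ h)) _ _ (begin
    ψ (g ∙ h) ∙ iter ψ (π (g ∙ h)) x   ≡⟨ skew (g ∙ h) x ⟨
    ψ ((g ∙ h) ∙ x)                    ≡⟨ cong ψ (assoc g h x) ⟩
    ψ (g ∙ (h ∙ x))                    ≡⟨ ψ-hom Ker-g (h ∙ x) ⟩
    ψ g ∙ ψ (h ∙ x)                    ≡⟨ cong (ψ g ∙_) (ψ-hom Ker-h x) ⟩
    ψ g ∙ (ψ h ∙ ψ x)                  ≡⟨ assoc (ψ g) (ψ h) (ψ x) ⟨
    (ψ g ∙ ψ h) ∙ ψ x                  ≡⟨ cong (_∙ ψ x) (ψ-hom Ker-g h) ⟨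
    ψ (g ∙ h) ∙ ψ x                    ∎)

  Ker-⁻¹ : ∀ {g} → Ker g → Ker (g ⁻¹)
  Ker-⁻¹ {g} Ker-g = π-minimal (g ⁻¹) λ x → sym (begin
    ψ x                                        ≡⟨ cong ψ (\\-leftDividesˡ g x) ⟨
    ψ (g ∙ ((g ⁻¹) ∙ x))                       ≡⟨ ψ-hom Ker-g ((g ⁻¹) ∙ x) ⟩
    ψ g ∙ ψ ((g ⁻¹) ∙ x)                       ≡⟨ cong (ψ g ∙_) (skew (g ⁻¹) x) ⟩
    ψ g ∙ (ψ (g ⁻¹) ∙ iter ψ (π (g ⁻¹)) x)     ≡⟨ assoc _ _ _ ⟨
    (ψ g ∙ ψ (g ⁻¹)) ∙ iter ψ (π (g ⁻¹)) x     ≡⟨ cong (_∙ _) (ψ-hom Ker-g (g ⁻¹)) ⟨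
    ψ (g ∙ (g ⁻¹)) ∙ iter ψ (π (g ⁻¹)) x       ≡⟨ cong (λ y → ψ y ∙ _) (inverseʳ g) ⟩
    ψ ε ∙ iter ψ (π (g ⁻¹)) x                  ≡⟨ cong (_∙ _) ψ-ε ⟩
    ε ∙ iter ψ (π (g ⁻¹)) x                    ≡⟨ identityˡ _ ⟩
    iter ψ (π (g ⁻¹)) x                        ∎)

  Ker-^ : ∀ {g} → Ker g → ∀ c → Ker (g ^ c)
  Ker-^ Ker-g zero    = Ker-ε
  Ker-^ Ker-g (suc c) = Ker-∙ Ker-g (Ker-^ Ker-g c)

  ψ-^ : ∀ {g} → Ker g → ∀ c → ψ (g ^ c) ≡ ψ g ^ c
  ψ-^ Ker-g zero    = ψ-ε
  ψ-^ {g} Ker-g (suc c) = trans (ψ-hom Ker-g (g ^ c)) (cong (ψ g ∙_) (ψ-^ Ker-g c))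

  ψ-^≡ε : ∀ {g} → Ker g → ∀ c → g ^ c ≡ ε → ψ g ^ c ≡ ε
  ψ-^≡ε {g} Ker-g c g^c≡ε = begin
    ψ g ^ c     ≡⟨ ψ-^ Ker-g c ⟨
    ψ (g ^ c)   ≡⟨ cong ψ g^c≡ε ⟩
    ψ ε         ≡⟨ ψ-ε ⟩
    ε           ∎

  ψ-square≡ε : ∀ {g} → Ker g → ψ g ∙ ψ g ≡ ε → g ∙ g ≡ ε
  ψ-square≡ε {g} Ker-g ψg²≡ε = ψ-injective (trans (ψ-hom Ker-g g) (trans ψg²≡ε (sym ψ-ε)))

  iter-ψ-hom : ∀ {S : A → Set} → (∀ {g} → S g → Ker g) → (∀ {g} → S g → S (ψ g)) →
               ∀ k {g} → S g → ∀ h → iter ψ k (g ∙ h) ≡ iter ψ k g ∙ iter ψ k h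
  iter-ψ-hom S⊆Ker ψ-preserves zero    Sg h = refl
  iter-ψ-hom {S} S⊆Ker ψ-preserves (suc k) {g} Sg h = trans
    (cong ψ (iter-ψ-hom {S} S⊆Ker ψ-preserves k Sg h))
    (ψ-hom (S⊆Ker {iter ψ k g} (iter-preserves {P = S} ψ-preserves k Sg)) (iter ψ k h))

module Modular (n : ℕ) {{_ : NonZero n}} where

  infix 4 _≈_
  _≈_ : Rel ℕ 0ℓ
  a ≈ b = a % n ≡ b % n

  ≈-setoid : Setoid 0ℓ 0ℓ
  ≈-setoid = record { _≈_ = _≈_ ; isEquivalence = On.isEquivalence (_% n) ≡.isEquivalence }

  module ≈-Reasoning = SetoidReasoning ≈-setoid
  open ≈-Reasoning

  %-≈ : ∀ a → a % n ≈ a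
  %-≈ a = m%n%n≡m%n a n

  +-cong : ∀ {a b c d} → a ≈ b → c ≈ d → a + c ≈ b + d
  +-cong {a} {b} {c} {d} a≈b c≈d =
    trans (%-distribˡ-+ a c n) (trans (cong₂ (λ u v → (u + v) % n) a≈b c≈d) (sym (%-distribˡ-+ b d n)))

  +-congˡ : ∀ a {b c} → b ≈ c → a + b ≈ a + c
  +-congˡ a = +-cong {a} refl

  +-congʳ : ∀ c {a b} → a ≈ b → a + c ≈ b + c
  +-congʳ c a≈b = +-cong a≈b (refl {x = c % n})

  *-congˡ : ∀ c {a b} → a ≈ b → c * a ≈ c * b
  *-congˡ c {a} {b} a≈b =
    trans (%-distribˡ-* c a n) (trans (cong (λ u → (c % n * u) % n) a≈b) (sym (%-distribˡ-* c b n)))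

  ∣⇒≈0 : ∀ {a} → n ∣ a → a ≈ 0
  ∣⇒≈0 {a} n∣a = trans (n∣m⇒m%n≡0 a n n∣a) (sym (n∣m⇒m%n≡0 0 n (n ∣0)))

  ≈0⇒∣ : ∀ {a} → a ≈ 0 → n ∣ a
  ≈0⇒∣ {a} a≈0 = m%n≡0⇒n∣m a n (trans a≈0 (n∣m⇒m%n≡0 0 n (n ∣0)))

  neg : ℕ → ℕ
  neg a = n ∸ a % n

  neg-cong : ∀ {a b} → a ≈ b → neg a ≡ neg b
  neg-cong = cong (n ∸_)

  +-inverseʳ : ∀ a → a + neg a ≈ 0
  +-inverseʳ a = begin
    a + neg a        ≈⟨ +-congʳ (neg a) (%-≈ a) ⟨
    a % n + neg a    ≡⟨ m+[n∸m]≡n (m%n≤n a n) ⟩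
    n                ≈⟨ ∣⇒≈0 n∣n ⟩
    0                ∎

  +-cancelʳ : ∀ c {a b} → a + c ≈ b + c → a ≈ b
  +-cancelʳ c {a} {b} eq = begin
    a                 ≡⟨ +-identityʳ a ⟨
    a + 0             ≈⟨ +-congˡ a (+-inverseʳ c) ⟨
    a + (c + neg c)   ≡⟨ +-assoc a c (neg c) ⟨
    a + c + neg c     ≈⟨ +-congʳ (neg c) eq ⟩
    b + c + neg c     ≡⟨ +-assoc b c (neg c) ⟩
    b + (c + neg c)   ≈⟨ +-congˡ b (+-inverseʳ c) ⟩
    b + 0             ≡⟨ +-identityʳ b ⟩
    b                 ∎

  +-cancelˡ : ∀ c {a b} → c + a ≈ c + b → a ≈ b
  +-cancelˡ c {a} {b} eq = +-cancelʳ c (begin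
    a + c   ≡⟨ +-comm a c ⟩
    c + a   ≈⟨ eq ⟩
    c + b   ≡⟨ +-comm c b ⟩
    b + c   ∎)

  neg-+ : ∀ a b → neg (a + b) ≈ neg a + neg b
  neg-+ a b = +-cancelˡ (a + b) (begin
    a + b + neg (a + b)          ≈⟨ +-inverseʳ (a + b) ⟩
    0                            ≈⟨ +-cong (+-inverseʳ a) (+-inverseʳ b) ⟨
    (a + neg a) + (b + neg b)    ≡⟨ interchange a (neg a) b (neg b) ⟩
    a + b + (neg a + neg b)      ∎)
    where
    interchange : ∀ w x y z → (w + x) + (y + z) ≡ (w + y) + (x + z)
    interchange = solve-∀

  neg-involutive : ∀ a → neg (neg a) ≈ a
  neg-involutive a = +-cancelˡ (neg a) (begin
    neg a + neg (neg a)   ≈⟨ +-inverseʳ (neg a) ⟩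
    0                     ≈⟨ +-inverseʳ a ⟨
    a + neg a             ≡⟨ +-comm a (neg a) ⟩
    neg a + a             ∎)

  -- b^s a^k = a^(act s k) b^s in D_n
  act : Bool → ℕ → ℕ
  act false a = a
  act true  a = neg a

  act-cong : ∀ s {a b} → a ≈ b → act s a ≈ act s b
  act-cong false a≈b = a≈b
  act-cong true  a≈b = cong (_% n) (neg-cong a≈b)

  act-+ : ∀ s a b → act s (a + b) ≈ act s a + act s b
  act-+ false a b = refl
  act-+ true  a b = neg-+ a b

  act-act : ∀ s t a → act s (act t a) ≈ act (s xor t) a
  act-act false t     a = refl
  act-act true  false a = refl
  act-act true  true  a = neg-involutive a

  act-0 : ∀ s → act s 0 ≈ 0
  act-0 false = refl
  act-0 true  = +-inverseʳ 0

  IsZeroOrHalf : ℕ → Set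
  IsZeroOrHalf a = a ≡ 0 ⊎ 2 * a ≡ n

  2*-≈0⇒IsZeroOrHalf : ∀ {a} → a < n → 2 * a ≈ 0 → IsZeroOrHalf a
  2*-≈0⇒IsZeroOrHalf {a} a<n 2a≈0 with ≈0⇒∣ 2a≈0
  ... | divides zero          2a≡0  = inj₁ (m+n≡0⇒m≡0 a 2a≡0)
  ... | divides (suc zero)    2a≡n  = inj₂ (trans 2a≡n (+-identityʳ n))
  ... | divides (suc (suc c)) 2a≡cn = ⊥-elim (<-irrefl 2a≡cn
        (<-≤-trans (*-monoʳ-< 2 a<n) (*-monoˡ-≤ n {2} {suc (suc c)} (s≤s (s≤s z≤n)))))

  IsZeroOrHalf-pigeonhole : ∀ {a b c} → IsZeroOrHalf a → IsZeroOrHalf b → IsZeroOrHalf c →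
                            a ≡ b ⊎ a ≡ c ⊎ b ≡ c
  IsZeroOrHalf-pigeonhole (inj₁ a≡0)  (inj₁ b≡0)  _           = inj₁ (trans a≡0 (sym b≡0))
  IsZeroOrHalf-pigeonhole (inj₂ 2a≡n) (inj₂ 2b≡n) _           = inj₁ (*-cancelˡ-≡ _ _ 2 (trans 2a≡n (sym 2b≡n)))
  IsZeroOrHalf-pigeonhole (inj₁ a≡0)  _           (inj₁ c≡0)  = inj₂ (inj₁ (trans a≡0 (sym c≡0)))
  IsZeroOrHalf-pigeonhole (inj₂ 2a≡n) _           (inj₂ 2c≡n) = inj₂ (inj₁ (*-cancelˡ-≡ _ _ 2 (trans 2a≡n (sym 2c≡n))))
  IsZeroOrHalf-pigeonhole _           (inj₁ b≡0)  (inj₁ c≡0)  = inj₂ (inj₂ (trans b≡0 (sym c≡0)))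
  IsZeroOrHalf-pigeonhole _           (inj₂ 2b≡n) (inj₂ 2c≡n) = inj₂ (inj₂ (*-cancelˡ-≡ _ _ 2 (trans 2b≡n (sym 2c≡n))))

  bézout : ∀ i → ∃ λ x → x * i ≈ gcd i n
  bézout i with Bézout.identity (gcd-GCD i n)
  ... | Bézout.+- x y eq = x , (begin
    x * i             ≡⟨ eq ⟨
    gcd i n + y * n   ≈⟨ +-congˡ (gcd i n) (∣⇒≈0 (n∣m*n y)) ⟩
    gcd i n + 0       ≡⟨ +-identityʳ (gcd i n) ⟩
    gcd i n           ∎)
  -- here x * i ≈ - gcd i n, so (n - 1) * x is a Bézout coefficient
  ... | Bézout.-+ x y eq = pred n * x , +-cancelʳ (x * i) (begin
    pred n * x * i + x * i   ≡⟨ distrib (pred n) x i ⟩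
    suc (pred n) * (x * i)   ≡⟨ cong (_* (x * i)) (suc-pred n) ⟩
    n * (x * i)              ≈⟨ ∣⇒≈0 (m∣m*n (x * i)) ⟩
    0                        ≈⟨ ∣⇒≈0 (n∣m*n y) ⟨
    y * n                    ≡⟨ eq ⟨
    gcd i n + x * i          ∎)
    where
    distrib : ∀ p x i → p * x * i + x * i ≡ suc p * (x * i)
    distrib = solve-∀

module DihedralGroup (n : ℕ) {{_ : NonZero n}} where

  open Dihedral n
  open Modular n
  open Power _·_ e public

  idx : D n → ℕ
  idx = toℕ ∘ proj₁

  toℕ-% : ∀ (i : Fin n) → toℕ i % n ≡ toℕ i
  toℕ-% i = m<n⇒m%n≡m (Fin.toℕ<n i)

  toℕ-mod : ∀ a → toℕ (a mod n) ≈ a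
  toℕ-mod a = trans (cong (_% n) (Fin.toℕ-fromℕ< _)) (%-≈ a)

  ≡-intro : ∀ {x y} → idx x ≈ idx y → proj₂ x ≡ proj₂ y → x ≡ y
  ≡-intro {i , s} {j , .s} i≈j refl =
    cong (_, s) (Fin.toℕ-injective (trans (sym (toℕ-% i)) (trans i≈j (toℕ-% j))))

  idx-· : ∀ x y → idx (x · y) ≈ idx x + act (proj₂ x) (idx y)
  idx-· (i , false) (j , t) = toℕ-mod (toℕ i + toℕ j)
  idx-· (i , true)  (j , t) =
    trans (toℕ-mod (toℕ i + (n ∸ toℕ j))) (cong (λ k → (toℕ i + (n ∸ k)) % n) (sym (toℕ-% j)))

  proj₂-· : ∀ x y → proj₂ (x · y) ≡ proj₂ x xor proj₂ y
  proj₂-· (i , false) y = refl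
  proj₂-· (i , true)  y = refl

  idx-e : idx e ≈ 0
  idx-e = toℕ-mod 0

  idx-inv : ∀ i → idx (inv (i , false)) ≈ neg (toℕ i)
  idx-inv i = trans (toℕ-mod (n ∸ toℕ i)) (cong (λ k → (n ∸ k) % n) (sym (toℕ-% i)))

  open Definitions {A = D n} _≡_

  ·-assoc : Associative _·_
  ·-assoc x y z = ≡-intro idx-assoc proj₂-assoc
    where
    s t : Bool
    s = proj₂ x
    t = proj₂ y
    idx-assoc : idx ((x · y) · z) ≈ idx (x · (y · z))
    idx-assoc = begin
      idx ((x · y) · z)                                 ≈⟨ idx-· (x · y) z ⟩
      idx (x · y) + act (proj₂ (x · y)) (idx z)         ≡⟨ cong (λ b → idx (x · y) + act b (idx z)) (proj₂-· x y) ⟩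
      idx (x · y) + act (s xor t) (idx z)               ≈⟨ +-congʳ (act (s xor t) (idx z)) (idx-· x y) ⟩
      idx x + act s (idx y) + act (s xor t) (idx z)     ≡⟨ +-assoc (idx x) _ _ ⟩
      idx x + (act s (idx y) + act (s xor t) (idx z))   ≈⟨ +-congˡ (idx x) (+-congˡ (act s (idx y)) (act-act s t (idx z))) ⟨
      idx x + (act s (idx y) + act s (act t (idx z)))   ≈⟨ +-congˡ (idx x) (act-+ s (idx y) _) ⟨
      idx x + act s (idx y + act t (idx z))             ≈⟨ +-congˡ (idx x) (act-cong s (idx-· y z)) ⟨
      idx x + act s (idx (y · z))                       ≈⟨ idx-· x (y · z) ⟨
      idx (x · (y · z))                                 ∎
      where open ≈-Reasoning
    proj₂-assoc : proj₂ ((x · y) · z) ≡ proj₂ (x · (y · z))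
    proj₂-assoc = begin
      proj₂ ((x · y) · z)        ≡⟨ proj₂-· (x · y) z ⟩
      proj₂ (x · y) xor proj₂ z  ≡⟨ cong (_xor proj₂ z) (proj₂-· x y) ⟩
      (s xor t) xor proj₂ z      ≡⟨ Bool.xor-assoc s t (proj₂ z) ⟩
      s xor (t xor proj₂ z)      ≡⟨ cong (s xor_) (proj₂-· y z) ⟨
      s xor proj₂ (y · z)        ≡⟨ proj₂-· x (y · z) ⟨
      proj₂ (x · (y · z))        ∎
      where open ≡-Reasoning

  ·-identityˡ : LeftIdentity e _·_
  ·-identityˡ x = ≡-intro (trans (idx-· e x) (+-congʳ (idx x) idx-e)) (proj₂-· e x)

  ·-identityʳ : RightIdentity e _·_
  ·-identityʳ (i , s) = ≡-intro idx-x·e≈ (trans (proj₂-· (i , s) e) (Bool.xor-identityʳ s))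
    where
    open ≈-Reasoning
    idx-x·e≈ : idx ((i , s) · e) ≈ toℕ i
    idx-x·e≈ = begin
      idx ((i , s) · e)     ≈⟨ idx-· (i , s) e ⟩
      toℕ i + act s (idx e) ≈⟨ +-congˡ (toℕ i) (act-cong s idx-e) ⟩
      toℕ i + act s 0       ≈⟨ +-congˡ (toℕ i) (act-0 s) ⟩
      toℕ i + 0             ≡⟨ +-identityʳ (toℕ i) ⟩
      toℕ i                 ∎

  ·-inverseʳ : RightInverse e inv _·_
  ·-inverseʳ (i , false) = ≡-intro (begin
    idx ((i , false) · inv (i , false))   ≈⟨ idx-· (i , false) (inv (i , false)) ⟩
    toℕ i + idx (inv (i , false))         ≈⟨ +-congˡ (toℕ i) (idx-inv i) ⟩
    toℕ i + neg (toℕ i)                   ≈⟨ +-inverseʳ (toℕ i) ⟩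
    0                                     ≈⟨ idx-e ⟨
    idx e                                 ∎) refl
    where open ≈-Reasoning
  ·-inverseʳ (i , true) = ≡-intro (begin
    idx ((i , true) · (i , true))         ≈⟨ idx-· (i , true) (i , true) ⟩
    toℕ i + neg (toℕ i)                   ≈⟨ +-inverseʳ (toℕ i) ⟩
    0                                     ≈⟨ idx-e ⟨
    idx e                                 ∎) refl
    where open ≈-Reasoning

  ·-inverseˡ : LeftInverse e inv _·_
  ·-inverseˡ (i , false) = ≡-intro (begin
    idx (inv (i , false) · (i , false))   ≈⟨ idx-· (inv (i , false)) (i , false) ⟩
    idx (inv (i , false)) + toℕ i         ≈⟨ +-congʳ (toℕ i) (idx-inv i) ⟩
    neg (toℕ i) + toℕ i                   ≡⟨ +-comm (neg (toℕ i)) (toℕ i) ⟩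
    toℕ i + neg (toℕ i)                   ≈⟨ +-inverseʳ (toℕ i) ⟩
    0                                     ≈⟨ idx-e ⟨
    idx e                                 ∎) refl
    where open ≈-Reasoning
  ·-inverseˡ (i , true) = ·-inverseʳ (i , true)

  ·-isGroup : Structures.IsGroup _≡_ _·_ e inv
  ·-isGroup = record
    { isMonoid = record
      { isSemigroup = record
        { isMagma = record { isEquivalence = ≡.isEquivalence ; ∙-cong = cong₂ _·_ }
        ; assoc = ·-assoc
        }
      ; identity = ·-identityˡ , ·-identityʳ
      }
    ; inverse = ·-inverseˡ , ·-inverseʳ
    ; ⁻¹-cong = cong inv
    }

  Dₙ : Group 0ℓ 0ℓ
  Dₙ = record { isGroup = ·-isGroup }

  open GroupProperties Dₙ using (//-rightDividesʳ; \\-leftDividesʳ) public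

  idx-·-C : ∀ {x} → InC x → ∀ y → idx (x · y) ≈ idx x + idx y
  idx-·-C {x} x∈C y = trans (idx-· x y) (cong (λ s → (idx x + act s (idx y)) % n) x∈C)

  C-· : ∀ {x y} → InC x → InC y → InC (x · y)
  C-· {x} {y} x∈C y∈C = trans (proj₂-· x y) (cong₂ _xor_ x∈C y∈C)

  C-inv : ∀ {x} → InC x → InC (inv x)
  C-inv {i , false} refl = refl

  C-^ : ∀ {x} → InC x → ∀ c → InC (x ^ c)
  C-^ x∈C zero    = refl
  C-^ x∈C (suc c) = C-· x∈C (C-^ x∈C c)

  idx-^ : ∀ {x} → InC x → ∀ c → idx (x ^ c) ≈ c * idx x
  idx-^ x∈C zero        = idx-e
  idx-^ {x} x∈C (suc c) = trans (idx-·-C x∈C (x ^ c)) (+-congˡ (idx x) (idx-^ x∈C c))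

  C-≡ : ∀ {x y} → InC x → InC y → idx x ≈ idx y → x ≡ y
  C-≡ x∈C y∈C idx-x≈idx-y = ≡-intro idx-x≈idx-y (trans x∈C (sym y∈C))

  C-comm : ∀ {x y} → InC x → InC y → x · y ≡ y · x
  C-comm {x} {y} x∈C y∈C = C-≡ (C-· x∈C y∈C) (C-· y∈C x∈C) (begin
    idx (x · y)     ≈⟨ idx-·-C x∈C y ⟩
    idx x + idx y   ≡⟨ +-comm (idx x) (idx y) ⟩
    idx y + idx x   ≈⟨ idx-·-C y∈C x ⟨
    idx (y · x)     ∎)
    where open ≈-Reasoning

  C-square-· : ∀ {x y} → InC x → InC y → (x · y) · (x · y) ≡ (x · x) · (y · y)
  C-square-· {x} {y} x∈C y∈C = begin
    (x · y) · (x · y)   ≡⟨ ·-assoc x y (x · y) ⟩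
    x · (y · (x · y))   ≡⟨ cong (x ·_) (·-assoc y x y) ⟨
    x · ((y · x) · y)   ≡⟨ cong (λ z → x · (z · y)) (C-comm y∈C x∈C) ⟩
    x · ((x · y) · y)   ≡⟨ cong (x ·_) (·-assoc x y y) ⟩
    x · (x · (y · y))   ≡⟨ ·-assoc x x (y · y) ⟨
    (x · x) · (y · y)   ∎
    where open ≡-Reasoning

  order∣⇒gcd∣ : ∀ {m y} → InC m → InC y → (∀ k → m ^ k ≡ e → y ^ k ≡ e) → gcd (idx m) n ∣ idx y
  order∣⇒gcd∣ {m} {y} m∈C y∈C order∣ with gcd[m,n]∣m (idx m) n | gcd[m,n]∣n (idx m) n
  ... | divides r idx-m≡r*d | divides q n≡q*d =
    *-cancelˡ-∣ q {{q≢0}} (subst (_∣ q * idx y) n≡q*d (≈0⇒∣ (begin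
      q * idx y     ≈⟨ idx-^ y∈C q ⟨
      idx (y ^ q)   ≡⟨ cong idx (order∣ q m^q≡e) ⟩
      idx e         ≈⟨ idx-e ⟩
      0             ∎)))
    where
    open ≈-Reasoning
    d : ℕ
    d = gcd (idx m) n
    q≢0 : NonZero q
    q≢0 = m*n≢0⇒m≢0 q {{subst NonZero n≡q*d it}}
    m^q≡e : m ^ q ≡ e
    m^q≡e = C-≡ (C-^ m∈C q) refl (begin
      idx (m ^ q)   ≈⟨ idx-^ m∈C q ⟩
      q * idx m     ≡⟨ cong (q *_) idx-m≡r*d ⟩
      q * (r * d)   ≡⟨ swap q r d ⟩
      r * (q * d)   ≡⟨ cong (r *_) n≡q*d ⟨
      r * n         ≈⟨ ∣⇒≈0 (n∣m*n r) ⟩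
      0             ≈⟨ idx-e ⟨
      idx e         ∎)
      where
      swap : ∀ a b c → a * (b * c) ≡ b * (a * c)
      swap = solve-∀

  gcd∣⇒∈-powers : ∀ {m y} → InC m → InC y → gcd (idx m) n ∣ idx y → ∃ λ c → y ≡ m ^ c
  gcd∣⇒∈-powers {m} {y} m∈C y∈C (divides c idx-y≡c*d) with bézout (idx m)
  ... | x , x*idx-m≈d = c * x , C-≡ y∈C (C-^ m∈C (c * x)) (begin
    idx y                ≡⟨ idx-y≡c*d ⟩
    c * gcd (idx m) n    ≈⟨ *-congˡ c x*idx-m≈d ⟨
    c * (x * idx m)      ≡⟨ *-assoc c x (idx m) ⟨
    c * x * idx m        ≈⟨ idx-^ m∈C (c * x) ⟨
    idx (m ^ (c * x))    ∎)
    where open ≈-Reasoning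

  ∈-powers : ∀ {m y} → InC m → InC y → (∀ k → m ^ k ≡ e → y ^ k ≡ e) → ∃ λ c → y ≡ m ^ c
  ∈-powers m∈C y∈C order∣ = gcd∣⇒∈-powers m∈C y∈C (order∣⇒gcd∣ m∈C y∈C order∣)

  reflection-square : ∀ {g} → proj₂ g ≡ true → g · g ≡ e
  reflection-square {i , true} refl = ·-inverseʳ (i , true)

  reflection-conj : ∀ {g m} → proj₂ g ≡ true → InC m → g · m ≡ inv m · g
  reflection-conj {i , true} {j , false} refl refl = ≡-intro (begin
    idx ((i , true) · (j , false))        ≈⟨ idx-· (i , true) (j , false) ⟩
    toℕ i + neg (toℕ j)                   ≡⟨ +-comm (toℕ i) (neg (toℕ j)) ⟩
    neg (toℕ j) + toℕ i                   ≈⟨ +-congʳ (toℕ i) (idx-inv j) ⟨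
    idx (inv (j , false)) + toℕ i         ≈⟨ idx-·-C refl (i , true) ⟨
    idx (inv (j , false) · (i , true))    ∎) refl
    where open ≈-Reasoning

  conj-C : ∀ g {m} → InC m → g · m · inv g ≡ m ⊎ g · m · inv g ≡ inv m
  conj-C g {m} m∈C with proj₂ g in g-type
  ... | false = inj₁ (trans (cong (_· inv g) (C-comm g-type m∈C)) (//-rightDividesʳ g m))
  ... | true  = inj₂ (trans (cong (_· inv g) (reflection-conj g-type m∈C)) (//-rightDividesʳ g (inv m)))

  C-involution : ∀ {x} → InC x → x · x ≡ e → IsZeroOrHalf (idx x)
  C-involution {x} x∈C x²≡e = 2*-≈0⇒IsZeroOrHalf (Fin.toℕ<n (proj₁ x)) (begin
    2 * idx x           ≡⟨ cong (idx x +_) (+-identityʳ (idx x)) ⟩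
    idx x + idx x       ≈⟨ idx-·-C x∈C x ⟨
    idx (x · x)         ≡⟨ cong idx x²≡e ⟩
    idx e               ≈⟨ idx-e ⟩
    0                   ∎)
    where open ≈-Reasoning

  infix 4 _≟_
  _≟_ : (x y : D n) → Dec (x ≡ y)
  _≟_ = Product.≡-dec Fin._≟_ Bool._≟_

  non-involution : ∀ {P : D n → Set} → (∀ {x} → P x → InC x) →
                   ∀ {xs} → Unique xs → All P xs → 2 < length xs → ∃ λ x → P x × x · x ≢ e
  non-involution P⊆C {[]}         _ _ ()
  non-involution P⊆C {_ ∷ []}     _ _ (s≤s ())
  non-involution P⊆C {_ ∷ _ ∷ []} _ _ (s≤s (s≤s ()))
  non-involution {P} P⊆C {x ∷ y ∷ z ∷ _} ((x≢y ∷ x≢z ∷ _) ∷ (y≢z ∷ _) ∷ _) (Px ∷ Py ∷ Pz ∷ _) _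
    with x · x ≟ e | y · y ≟ e | z · z ≟ e
  ... | no x²≢e | _       | _       = x , Px , x²≢e
  ... | yes _   | no y²≢e | _       = y , Py , y²≢e
  ... | yes _   | yes _   | no z²≢e = z , Pz , z²≢e
  ... | yes x²  | yes y²  | yes z²  =
    ⊥-elim ([ x≢y ∘ idx-injective Px Py , [ x≢z ∘ idx-injective Px Pz , y≢z ∘ idx-injective Py Pz ] ]
      (IsZeroOrHalf-pigeonhole (C-involution (P⊆C Px) x²) (C-involution (P⊆C Py) y²)
                               (C-involution (P⊆C Pz) z²)))
    where
    idx-injective : ∀ {u v} → P u → P v → idx u ≡ idx v → u ≡ v
    idx-injective Pu Pv = C-≡ (P⊆C Pu) (P⊆C Pv) ∘ cong (_% n)

  elems-unique : Unique elems
  elems-unique = subst Unique (sym (elems≡cartesianProduct (allFin n)))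
    (cartesianProduct⁺ (allFin⁺ n) (((λ ()) ∷ []) ∷ [] ∷ []))
    where
    elems≡cartesianProduct : ∀ is → concatMap (λ i → (i , false) ∷ (i , true) ∷ []) is ≡
                                    cartesianProduct is (false ∷ true ∷ [])
    elems≡cartesianProduct []       = refl
    elems≡cartesianProduct (i ∷ is) =
      cong (λ l → (i , false) ∷ (i , true) ∷ l) (elems≡cartesianProduct is)

module DihedralSkewMorphism (n : ℕ) {{_ : NonZero n}} {ψ : D n → D n} {π : D n → ℕ}
  (skew-morphism : Dihedral.IsSkewMorphism n ψ π) where

  open Dihedral n
  open DihedralGroup n
  open IsSkewMorphism skew-morphism

  ψ-injective : ∀ {x y} → ψ x ≡ ψ y → x ≡ y
  ψ-injective {x} {y} ψx≡ψy = trans (sym (inv-left x)) (trans (cong ψ⁻¹ ψx≡ψy) (inv-left y))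

  ψ^k≗ψ⇒k≡1 : ∀ k → 1 ≤ k → k ≤ order → (∀ h → iter ψ k h ≡ ψ h) → k ≡ 1
  ψ^k≗ψ⇒k≡1 (suc zero)    _ _       _   = refl
  ψ^k≗ψ⇒k≡1 (suc (suc k)) _ k<order ψ^k≗ψ =
    ⊥-elim (order-min (suc k) (s≤s z≤n) k<order λ h → ψ-injective (ψ^k≗ψ h))

  π-minimal : ∀ g → (∀ h → iter ψ (π g) h ≡ ψ h) → π g ≡ 1
  π-minimal g = ψ^k≗ψ⇒k≡1 (π g) (proj₁ (π-range g)) (proj₂ (π-range g))

  open SkewMorphismKernel ·-isGroup ψ π ψ-injective fixes-1 skew π-minimal

  M-e : InM π e
  M-e = refl , Ker-ε

  M-· : ∀ {x y} → InM π x → InM π y → InM π (x · y)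
  M-· (x∈C , x∈Ker) (y∈C , y∈Ker) = C-· x∈C y∈C , Ker-∙ x∈Ker y∈Ker

  M-inv : ∀ {x} → InM π x → InM π (inv x)
  M-inv (x∈C , x∈Ker) = C-inv x∈C , Ker-⁻¹ x∈Ker

  M-^ : ∀ {x} → InM π x → ∀ c → InM π (x ^ c)
  M-^ (x∈C , x∈Ker) c = C-^ x∈C c , Ker-^ x∈Ker c

  M-conj : ∀ g {m} → InM π m → InM π (g · m · inv g)
  M-conj g {m} m∈M =
    [ (λ eq → subst (InM π) (sym eq) m∈M) , (λ eq → subst (InM π) (sym eq) (M-inv m∈M)) ]
      (conj-C g (proj₁ m∈M))

  reflection-image⇒involution : ∀ {m} → InM π m → proj₂ (ψ m) ≡ true → m · m ≡ e
  reflection-image⇒involution (_ , m∈Ker) ψm-reflection =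
    ψ-square≡ε m∈Ker (reflection-square ψm-reflection)

  module _ {m₁} (m₁∈M : InM π m₁) (m₁²≢e : m₁ · m₁ ≢ e) where

    ψ[M]⊆C : ∀ {m} → InM π m → InC (ψ m)
    ψ[M]⊆C {m} m∈M with proj₂ (ψ m) in ψm-type | proj₂ (ψ m₁) in ψm₁-type
    ... | false | _     = refl
    ... | true  | true  = ⊥-elim (m₁²≢e (reflection-image⇒involution m₁∈M ψm₁-type))
    ... | true  | false = ⊥-elim (m₁²≢e (begin
      m₁ · m₁                     ≡⟨ ·-identityˡ (m₁ · m₁) ⟨
      e · (m₁ · m₁)               ≡⟨ cong (_· (m₁ · m₁)) (reflection-image⇒involution m∈M ψm-type) ⟨
      (m · m) · (m₁ · m₁)         ≡⟨ C-square-· (proj₁ m∈M) (proj₁ m₁∈M) ⟨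
      (m · m₁) · (m · m₁)         ≡⟨ reflection-image⇒involution (M-· m∈M m₁∈M) ψ[mm₁]-type ⟩
      e                           ∎))
      where
      open ≡-Reasoning
      ψ[mm₁]-type : proj₂ (ψ (m · m₁)) ≡ true
      ψ[mm₁]-type = begin
        proj₂ (ψ (m · m₁))               ≡⟨ cong proj₂ (ψ-hom (proj₂ m∈M) m₁) ⟩
        proj₂ (ψ m · ψ m₁)               ≡⟨ proj₂-· (ψ m) (ψ m₁) ⟩
        proj₂ (ψ m) xor proj₂ (ψ m₁)     ≡⟨ cong₂ _xor_ ψm-type ψm₁-type ⟩
        true                             ∎

    ψ[M]⊆M : ∀ {m} → InM π m → InM π (ψ m)
    ψ[M]⊆M {m} m∈M = subst (InM π) (sym (proj₂ ψm∈⟨m⟩)) (M-^ m∈M (proj₁ ψm∈⟨m⟩))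
      where
      ψm∈⟨m⟩ : ∃ λ c → ψ m ≡ m ^ c
      ψm∈⟨m⟩ = ∈-powers (proj₁ m∈M) (ψ[M]⊆C m∈M) (ψ-^≡ε (proj₂ m∈M))

  M-non-involution : 2 < cardM π → ∃ λ m₁ → InM π m₁ × m₁ · m₁ ≢ e
  M-non-involution = non-involution proj₁ (filter⁺ M? elems-unique) (all-filter M? elems)
    where
    -- must be the decision procedure used in the definition of cardM
    M? : ∀ g → Dec (InM π g)
    M? g = (proj₂ g Bool.≟ false) ×-dec (π g ℕ.≟ 1)

  2<|M|⇒ψ[M]⊆M : 2 < cardM π → ∀ {m} → InM π m → InM π (ψ m)
  2<|M|⇒ψ[M]⊆M 2<|M| with M-non-involution 2<|M|
  ... | m₁ , m₁∈M , m₁²≢e = ψ[M]⊆M m₁∈M m₁²≢e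

  L[M]-normal : (∀ {m} → InM π m → InM π (ψ m)) → ∀ (g : D n) (k : ℕ) m → InM π m →
    Σ (D n) λ m' → InM π m' × (∀ h → g · iter ψ k (m · h) ≡ m' · (g · iter ψ k h))
  L[M]-normal ψ-invariant g k m m∈M = g · mₖ · inv g , M-conj g mₖ∈M , λ h → begin
    g · iter ψ k (m · h)                  ≡⟨ cong (g ·_) (iter-ψ-hom {S = InM π} proj₂ ψ-invariant k m∈M h) ⟩
    g · (mₖ · iter ψ k h)                 ≡⟨ ·-assoc g mₖ (iter ψ k h) ⟨
    g · mₖ · iter ψ k h                   ≡⟨ cong (g · mₖ ·_) (\\-leftDividesʳ g (iter ψ k h)) ⟨
    g · mₖ · (inv g · (g · iter ψ k h))   ≡⟨ ·-assoc (g · mₖ) (inv g) (g · iter ψ k h) ⟨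
    g · mₖ · inv g · (g · iter ψ k h)     ∎
    where
    open ≡-Reasoning
    mₖ : D n
    mₖ = iter ψ k m
    mₖ∈M : InM π mₖ
    mₖ∈M = iter-preserves {P = InM π} ψ-invariant k m∈M

corollary4p2 : (n : ℕ) {{_ : NonZero n}} →
    let open Dihedral n in
    (X : D n → Bool) (p ψ : D n → D n) (π : D n → ℕ) →
    IsRegularCayleyMapWith X p ψ π →
    2 < cardM π →
    LMNormalInAut ψ π
corollary4p2 n X p ψ π regular 2<|M| =
  M-e , (λ _ _ → M-·) , (λ _ → M-inv) , L[M]-normal (2<|M|⇒ψ[M]⊆M 2<|M|)
  where open DihedralSkewMorphism n (Dihedral.IsRegularCayleyMapWith.skew-morph regular)
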